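{- Let $a,b,c,d$ be complex numbers and, for integers $n\ge0$, $$\Xi_n(a,b,c,d):=\sum_{k=0}^{n-1}q^k\frac{(a,b;q)_k(c;q^2)_k}{(d,c/(dq);q)_{k+1}(abq;q^2)_k}.$$ Then for every integer $n\ge0$ (whenever no denominator vanishes) $$\Xi_n(a,b,c,d)=\frac{d(a;q)_2(c-abq)}{(c-adq)(d-a)(1-abq)}\Xi_n(aq^2,b,c,d)+\frac{aq}{(c-adq)(1-a/d)}\left\{1-\frac{(a,b;q)_n(c;q^2)_n}{(d,c/(dq);q)_n(abq;q^2)_n}\right\}.$$
   Context: $q$ is a complex number with $|q|<1$. For a base $p$ and integer $k\ge0$, $(z;p)_k:=\prod_{j=0}^{k-1}(1-zp^j)$, and $(z_1,\dots,z_m;p)_k:=(z_1;p)_k\cdots(z_m;p)_k$. -}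

module Defs where

open import Level using (Level; suc; _⊔_)
open import Algebra.Bundles using (CommutativeRing)
open import Data.Nat using (ℕ; zero) renaming (suc to sucℕ)
open import Relation.Nullary using (¬_)

record Field (c ℓ : Level) : Set (suc (c ⊔ ℓ)) where
  field
    commutativeRing : CommutativeRing c ℓ
  open CommutativeRing commutativeRing public
  field
    _⁻¹        : Carrier → Carrier
    ⁻¹-inverse : ∀ x → ¬ (x ≈ 0#) → x * (x ⁻¹) ≈ 1#
    0≉1        : ¬ (0# ≈ 1#)

  infixl 7 _/_
  _/_ : Carrier → Carrier → Carrier
  x / y = x * (y ⁻¹)

  pow : Carrier → ℕ → Carrier
  pow x zero     = 1#
  pow x (sucℕ n) = pow x n * x

  poch : Carrier → Carrier → ℕ → Carrier
  poch z p zero     = 1#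
  poch z p (sucℕ k) = poch z p k * (1# - z * pow p k)

  sumTo : ℕ → (ℕ → Carrier) → Carrier
  sumTo zero     f = 0#
  sumTo (sucℕ n) f = sumTo n f + f n

  Xi : (q a b c d : Carrier) → ℕ → Carrier
  Xi q a b c d n = sumTo n (λ k →
      pow q k * (poch a q k * poch b q k * poch c (q * q) k)
        / (poch d q (sucℕ k) * poch (c / (d * q)) q (sucℕ k)
           * poch (a * b * q) (q * q) k))

{-# OPTIONS --safe #-}
-- Write t_k(a) for the k-th summand of Ξ and r_k(a) for the ratio in braces, so r_0 = 1.
-- The identity is a telescoping sum of the termwise relation
--   t_k(a) = C t_k(aq²) + D (r_k(a) - r_{k+1}(a)).
-- Dividing by r_k(a) and putting x = q^k, all three terms become rational functions of x:
-- t_k(a)/r_k(a) = x/((1-dx)(1-cx/(dq))), r_{k+1}/r_k = (1-ax)(1-bx)(1-cx²)/((1-dx)(1-cx/(dq))(1-abqx²)),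
-- and t_k(aq²)/r_k(a) = t_k(a)/r_k(a) · (1-ax)(1-axq)(1-abq)/((a;q)_2 (1-abqx²)).
-- Clearing denominators leaves a polynomial identity in a, b, c, d, q, x.
module Submission where

open import Defs
open import Algebra.Bundles using (CommutativeRing)
open import Data.Nat.Base as ℕ using (ℕ; zero; _<_; _≤_) renaming (suc to sucℕ)
import Data.Nat.Properties as ℕ
open import Data.Integer.Base as ℤ using (ℤ; +_; -[1+_]; _⊖_; _◃_)
import Data.Integer.Properties as ℤ
open import Data.Sign.Base as Sign using ()
open import Data.Maybe.Base using (map)
open import Data.Sum.Base using (inj₁; inj₂)
open import Function.Base using (_∘_)
open import Relation.Binary.Consequences using (dec⇒weaklyDec)
import Relation.Binary.PropositionalEquality.Core as ≡

-- The ring solver with integer coefficients, usable in any commutative ring: with the ring's own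
-- elements as coefficients, cancelling monomials could not be recognised since ≈ is undecidable.
module IntegerCoefficients {c ℓ} (R : CommutativeRing c ℓ) where
  open CommutativeRing R
  open import Algebra.Properties.Ring ring
  open import Algebra.Properties.Semiring.Mult.TCOptimised semiring
    using (_×_; ×-homo-+; ×1-homo-*)
  open import Algebra.Solver.Ring.AlmostCommutativeRing
    using (fromCommutativeRing; _-Raw-AlmostCommutative⟶_)
  open import Relation.Binary.Reasoning.Setoid setoid

  ⟦_⟧ℤ : ℤ → Carrier
  ⟦ + n ⟧ℤ      = n × 1#
  ⟦ -[1+ n ] ⟧ℤ = - (sucℕ n × 1#)

  private
    +-cancel-− : ∀ u x y → (u + x) - (u + y) ≈ x - y
    +-cancel-− u x y = begin
      (u + x) - (u + y)     ≈⟨ +-cong (+-comm x u) (-‿+-comm u y) ⟨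
      (x + u) + (- u - y)   ≈⟨ +-assoc x u (- u - y) ⟩
      x + (u + (- u - y))   ≈⟨ +-congˡ (+-assoc u (- u) (- y)) ⟨
      x + ((u - u) - y)     ≈⟨ +-congˡ (+-congʳ (-‿inverseʳ u)) ⟩
      x + (0# - y)          ≈⟨ +-congˡ (+-identityˡ (- y)) ⟩
      x - y                 ∎

    ⊖-homo : ∀ m n → ⟦ m ⊖ n ⟧ℤ ≈ m × 1# - n × 1#
    ⊖-homo m       zero    = sym (trans (+-congˡ -0#≈0#) (+-identityʳ _))
    ⊖-homo zero    (sucℕ n) = sym (+-identityˡ _)
    ⊖-homo (sucℕ m) (sucℕ n) rewrite ℤ.[1+m]⊖[1+n]≡m⊖n m n = begin
      ⟦ m ⊖ n ⟧ℤ                          ≈⟨ ⊖-homo m n ⟩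
      m × 1# - n × 1#                     ≈⟨ +-cancel-− 1# (m × 1#) (n × 1#) ⟨
      (1# + m × 1#) - (1# + n × 1#)       ≈⟨ +-cong (×-homo-+ 1# 1 m) (-‿cong (×-homo-+ 1# 1 n)) ⟨
      sucℕ m × 1# - sucℕ n × 1#             ∎

    ◃-homo-+ : ∀ n → ⟦ Sign.+ ◃ n ⟧ℤ ≈ n × 1#
    ◃-homo-+ zero    = refl
    ◃-homo-+ (sucℕ n) = refl

    ◃-homo-− : ∀ n → ⟦ Sign.- ◃ n ⟧ℤ ≈ - (n × 1#)
    ◃-homo-− zero    = sym -0#≈0#
    ◃-homo-− (sucℕ n) = refl

  morphism : ℤ.+-*-rawRing -Raw-AlmostCommutative⟶ fromCommutativeRing R
  morphism = record
    { ⟦_⟧    = ⟦_⟧ℤ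
    ; +-homo = +-homo
    ; *-homo = *-homo
    ; -‿homo = -‿homo
    ; 0-homo = refl
    ; 1-homo = refl
    }
    where
    +-homo : ∀ i j → ⟦ i ℤ.+ j ⟧ℤ ≈ ⟦ i ⟧ℤ + ⟦ j ⟧ℤ
    +-homo (+ m)    (+ n)    = ×-homo-+ 1# m n
    +-homo (+ m)    -[1+ n ] = ⊖-homo m (sucℕ n)
    +-homo -[1+ m ] (+ n)    = trans (⊖-homo n (sucℕ m)) (+-comm _ _)
    +-homo -[1+ m ] -[1+ n ] = begin
      - (sucℕ (sucℕ (m ℕ.+ n)) × 1#)        ≡⟨ ≡.cong (λ k → - (k × 1#)) (ℕ.+-suc (sucℕ m) n) ⟨
      - ((sucℕ m ℕ.+ sucℕ n) × 1#)          ≈⟨ -‿cong (×-homo-+ 1# (sucℕ m) (sucℕ n)) ⟩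
      - (sucℕ m × 1# + sucℕ n × 1#)         ≈⟨ -‿+-comm _ _ ⟨
      - (sucℕ m × 1#) - sucℕ n × 1#         ∎

    *-homo : ∀ i j → ⟦ i ℤ.* j ⟧ℤ ≈ ⟦ i ⟧ℤ * ⟦ j ⟧ℤ
    *-homo (+ m) (+ n) = trans (◃-homo-+ (m ℕ.* n)) (×1-homo-* m n)
    *-homo (+ m) -[1+ n ] = begin
      ⟦ Sign.- ◃ (m ℕ.* sucℕ n) ⟧ℤ   ≈⟨ ◃-homo-− (m ℕ.* sucℕ n) ⟩
      - ((m ℕ.* sucℕ n) × 1#)         ≈⟨ -‿cong (×1-homo-* m (sucℕ n)) ⟩
      - (m × 1# * (sucℕ n × 1#))      ≈⟨ -‿distribʳ-* _ _ ⟩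
      m × 1# * - (sucℕ n × 1#)        ∎
    *-homo -[1+ m ] (+ n) = begin
      ⟦ Sign.- ◃ (sucℕ m ℕ.* n) ⟧ℤ   ≈⟨ ◃-homo-− (sucℕ m ℕ.* n) ⟩
      - ((sucℕ m ℕ.* n) × 1#)         ≈⟨ -‿cong (×1-homo-* (sucℕ m) n) ⟩
      - (sucℕ m × 1# * (n × 1#))      ≈⟨ -‿distribˡ-* _ _ ⟩
      - (sucℕ m × 1#) * n × 1#        ∎
    *-homo -[1+ m ] -[1+ n ] = begin
      (sucℕ m ℕ.* sucℕ n) × 1#               ≈⟨ ×1-homo-* (sucℕ m) (sucℕ n) ⟩
      sucℕ m × 1# * (sucℕ n × 1#)            ≈⟨ -‿involutive _ ⟨
      - - (sucℕ m × 1# * (sucℕ n × 1#))      ≈⟨ -‿cong (-‿distribʳ-* _ _) ⟩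
      - (sucℕ m × 1# * - (sucℕ n × 1#))      ≈⟨ -‿distribˡ-* _ _ ⟩
      - (sucℕ m × 1#) * - (sucℕ n × 1#)      ∎

    -‿homo : ∀ i → ⟦ ℤ.- i ⟧ℤ ≈ - ⟦ i ⟧ℤ
    -‿homo (+ zero)   = sym -0#≈0#
    -‿homo (+ sucℕ n) = refl
    -‿homo -[1+ n ]   = sym (-‿involutive _)

  open import Algebra.Solver.Ring ℤ.+-*-rawRing (fromCommutativeRing R) morphism
    (λ i j → map (λ i≡j → reflexive (≡.cong ⟦_⟧ℤ i≡j)) (dec⇒weaklyDec ℤ._≟_ i j))
    public

  :0 :1 : ∀ {n} → Polynomial n
  :0 = con (+ 0)
  :1 = con (+ 1)

module Recurrence {ℓc ℓ} (F : Field ℓc ℓ) where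
  open Field F
  open IntegerCoefficients commutativeRing
    using (solve; _:=_; _:+_; _:*_; _:-_; :0; :1)
  open import Algebra.Properties.CommutativeSemigroup *-commutativeSemigroup
    using (xy∙z≈xz∙y; interchange)
  open import Relation.Binary.Reasoning.Setoid setoid

  ≉0-resp-≈ : ∀ {x y} → x ≈ y → x ≉ 0# → y ≉ 0#
  ≉0-resp-≈ x≈y x≉0 y≈0 = x≉0 (trans x≈y y≈0)

  ≉0-factorˡ : ∀ {x y} → x * y ≉ 0# → x ≉ 0#
  ≉0-factorˡ {y = y} xy≉0 x≈0 = xy≉0 (trans (*-congʳ x≈0) (zeroˡ y))

  ≉0-factorʳ : ∀ {x y} → x * y ≉ 0# → y ≉ 0#
  ≉0-factorʳ {x = x} xy≉0 y≈0 = xy≉0 (trans (*-congˡ y≈0) (zeroʳ x))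

  x*y/y≈x : ∀ x {y} → y ≉ 0# → x * y / y ≈ x
  x*y/y≈x x {y} y≉0 = begin
    x * y * y ⁻¹    ≈⟨ *-assoc x y (y ⁻¹) ⟩
    x * (y * y ⁻¹)  ≈⟨ *-congˡ (⁻¹-inverse y y≉0) ⟩
    x * 1#          ≈⟨ *-identityʳ x ⟩
    x               ∎

  x/y*y≈x : ∀ x {y} → y ≉ 0# → x / y * y ≈ x
  x/y*y≈x x {y} y≉0 = trans (xy∙z≈xz∙y x (y ⁻¹) y) (x*y/y≈x x y≉0)

  *-cancelʳ-≉0 : ∀ {x y z} → z ≉ 0# → x * z ≈ y * z → x ≈ y
  *-cancelʳ-≉0 {x} {y} {z} z≉0 xz≈yz = begin
    x          ≈⟨ x*y/y≈x x z≉0 ⟨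
    x * z / z  ≈⟨ *-congʳ xz≈yz ⟩
    y * z / z  ≈⟨ x*y/y≈x y z≉0 ⟩
    y          ∎

  *-≉0 : ∀ {x y} → x ≉ 0# → y ≉ 0# → x * y ≉ 0#
  *-≉0 {x} {y} x≉0 y≉0 xy≈0 = x≉0 (*-cancelʳ-≉0 y≉0 (trans xy≈0 (sym (zeroˡ y))))

  sumTo-telescope : ∀ n {f g r : ℕ → Carrier} {u v : Carrier} →
    (∀ k → k < n → f k ≈ u * g k + v * (r k - r (sucℕ k))) →
    sumTo n f ≈ u * sumTo n g + v * (r 0 - r n)
  sumTo-telescope zero {r = r} {u} {v} _ =
    solve 3 (λ u v r₀ → :0 := u :* :0 :+ v :* (r₀ :- r₀)) refl u v (r 0)
  sumTo-telescope (sucℕ n) {f} {g} {r} {u} {v} step = begin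
    sumTo n f + f n
      ≈⟨ +-cong (sumTo-telescope n (λ k k<n → step k (ℕ.m<n⇒m<1+n k<n))) (step n ℕ.≤-refl) ⟩
    u * sumTo n g + v * (r 0 - r n) + (u * g n + v * (r n - r (sucℕ n)))
      ≈⟨ solve 7 (λ u v G g r₀ rₙ rₙ₊₁ → u :* G :+ v :* (r₀ :- rₙ) :+ (u :* g :+ v :* (rₙ :- rₙ₊₁))
                                    := u :* (G :+ g) :+ v :* (r₀ :- rₙ₊₁))
           refl u v (sumTo n g) (g n) (r 0) (r n) (r (sucℕ n)) ⟩
    u * (sumTo n g + g n) + v * (r 0 - r (sucℕ n)) ∎

  pow-square : ∀ p k → pow (p * p) k ≈ pow p k * pow p k
  pow-square p zero     = sym (*-identityˡ 1#)
  pow-square p (sucℕ k) = trans (*-congʳ (pow-square p k)) (interchange (pow p k) (pow p k) p p)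

  poch-congˡ : ∀ {z w} p k → z ≈ w → poch z p k ≈ poch w p k
  poch-congˡ p zero     z≈w = refl
  poch-congˡ p (sucℕ k) z≈w = *-cong (poch-congˡ p k z≈w) (+-congˡ (-‿cong (*-congʳ z≈w)))

  poch-suc-shift : ∀ z p k → poch z p (sucℕ k) ≈ (1# - z) * poch (z * p) p k
  poch-suc-shift z p zero = solve 1 (λ z → :1 :* (:1 :- z :* :1) := (:1 :- z) :* :1) refl z
  poch-suc-shift z p (sucℕ k) = begin
    poch z p (sucℕ k) * (1# - z * (pow p k * p))
      ≈⟨ *-congʳ (poch-suc-shift z p k) ⟩
    (1# - z) * poch (z * p) p k * (1# - z * (pow p k * p))
      ≈⟨ solve 4 (λ z p y P → (:1 :- z) :* P :* (:1 :- z :* (y :* p)) := (:1 :- z) :* (P :* (:1 :- z :* p :* y)))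
           refl z p (pow p k) (poch (z * p) p k) ⟩
    (1# - z) * poch (z * p) p (sucℕ k) ∎

  poch-shift₂ : ∀ z p k → poch (z * (p * p)) p k * poch z p 2 ≈ poch z p (sucℕ (sucℕ k))
  poch-shift₂ z p k = begin
    poch (z * (p * p)) p k * poch z p 2
      ≈⟨ *-congʳ (poch-congˡ p k (sym (*-assoc z p p))) ⟩
    poch (z * p * p) p k * poch z p 2
      ≈⟨ solve 3 (λ z p P → P :* (:1 :* (:1 :- z :* :1) :* (:1 :- z :* (:1 :* p))) := (:1 :- z) :* ((:1 :- z :* p) :* P))
           refl z p (poch (z * p * p) p k) ⟩
    (1# - z) * ((1# - z * p) * poch (z * p * p) p k)
      ≈⟨ *-congˡ (poch-suc-shift (z * p) p k) ⟨
    (1# - z) * poch (z * p) p (sucℕ k)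
      ≈⟨ poch-suc-shift z p (sucℕ k) ⟨
    poch z p (sucℕ (sucℕ k)) ∎

  /-rescale : ∀ {n₀ n₁ d₀ d₁ s t w} → d₀ ≉ 0# → d₁ ≉ 0# →
    d₁ * w ≈ d₀ * s → n₁ * w ≈ n₀ * t → n₁ / d₁ * s ≈ n₀ / d₀ * t
  /-rescale {n₀} {n₁} {d₀} {d₁} {s} {t} {w} d₀≉0 d₁≉0 d₁w≈d₀s n₁w≈n₀t =
    *-cancelʳ-≉0 d₀≉0 (begin
      n₁ / d₁ * s * d₀       ≈⟨ *-assoc (n₁ / d₁) s d₀ ⟩
      n₁ / d₁ * (s * d₀)     ≈⟨ *-congˡ (trans (*-comm s d₀) (sym d₁w≈d₀s)) ⟩
      n₁ / d₁ * (d₁ * w)     ≈⟨ *-assoc (n₁ / d₁) d₁ w ⟨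
      n₁ / d₁ * d₁ * w       ≈⟨ *-congʳ (x/y*y≈x n₁ d₁≉0) ⟩
      n₁ * w                 ≈⟨ n₁w≈n₀t ⟩
      n₀ * t                 ≈⟨ *-congʳ (x/y*y≈x n₀ d₀≉0) ⟨
      n₀ / d₀ * d₀ * t       ≈⟨ xy∙z≈xz∙y (n₀ / d₀) d₀ t ⟩
      n₀ / d₀ * t * d₀       ∎)

  ratioNum : (q a b c : Carrier) → ℕ → Carrier
  ratioNum q a b c k = poch a q k * poch b q k * poch c (q * q) k

  ratioDen : (q a b c d : Carrier) → ℕ → Carrier
  ratioDen q a b c d k = poch d q k * poch (c / (d * q)) q k * poch (a * b * q) (q * q) k

  ratio : (q a b c d : Carrier) → ℕ → Carrier
  ratio q a b c d k = ratioNum q a b c k / ratioDen q a b c d k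

  summandDen : (q a b c d : Carrier) → ℕ → Carrier
  summandDen q a b c d k =
    poch d q (sucℕ k) * poch (c / (d * q)) q (sucℕ k) * poch (a * b * q) (q * q) k

  summand : (q a b c d : Carrier) → ℕ → Carrier
  summand q a b c d k = pow q k * ratioNum q a b c k / summandDen q a b c d k

  ratio-zero : ∀ q a b c d → ratio q a b c d 0 ≈ 1#
  ratio-zero q a b c d = ⁻¹-inverse (1# * 1# * 1#) (≉0-resp-≈ 1≈1·1·1 (0≉1 ∘ sym))
    where
    1≈1·1·1 : 1# ≈ 1# * 1# * 1#
    1≈1·1·1 = sym (trans (*-identityʳ (1# * 1#)) (*-identityʳ 1#))

  module Contiguity (q a b c d : Carrier) where

    e β Δ₁ Δ₂ C D : Carrier
    e  = c / (d * q)
    β  = 1# - a * b * q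
    Δ₁ = (c - a * d * q) * (d - a) * β
    Δ₂ = (c - a * d * q) * (1# - a / d)
    C  = d * poch a q 2 * (c - a * b * q) / Δ₁
    D  = a * q / Δ₂

    module _ (k : ℕ) where

      x δ₁ δ₂ γ φ ψ U V : Carrier
      x  = pow q k
      δ₁ = 1# - d * x
      δ₂ = 1# - e * x
      γ  = 1# - a * b * q * (x * x)
      φ  = (1# - a * x) * (1# - b * x) * (1# - c * (x * x))
      ψ  = (1# - a * x) * (1# - a * (x * q)) * β
      U  = d * q - c * x
      V  = (c - a * d * q) * (d * q - a * q)

      1-z·q²ᵏ≈1-z·x² : ∀ z → 1# - z * pow (q * q) k ≈ 1# - z * (x * x)
      1-z·q²ᵏ≈1-z·x² z = +-congˡ (-‿cong (*-congˡ (pow-square q k)))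

      summandDen≈ratioDen*δ₁δ₂ : summandDen q a b c d k ≈ ratioDen q a b c d k * (δ₁ * δ₂)
      summandDen≈ratioDen*δ₁δ₂ =
        solve 5 (λ P δ₁ E δ₂ G → P :* δ₁ :* (E :* δ₂) :* G := P :* E :* G :* (δ₁ :* δ₂))
          refl (poch d q k) δ₁ (poch e q k) δ₂ (poch (a * b * q) (q * q) k)

      ratioDen-suc : ratioDen q a b c d (sucℕ k) ≈ ratioDen q a b c d k * (δ₁ * δ₂ * γ)
      ratioDen-suc = begin
        poch d q k * δ₁ * (poch e q k * δ₂) * (poch (a * b * q) (q * q) k * (1# - a * b * q * pow (q * q) k))
          ≈⟨ *-congˡ (*-congˡ (1-z·q²ᵏ≈1-z·x² (a * b * q))) ⟩
        poch d q k * δ₁ * (poch e q k * δ₂) * (poch (a * b * q) (q * q) k * γ)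
          ≈⟨ solve 6 (λ P δ₁ E δ₂ G γ → P :* δ₁ :* (E :* δ₂) :* (G :* γ) := P :* E :* G :* (δ₁ :* δ₂ :* γ))
               refl (poch d q k) δ₁ (poch e q k) δ₂ (poch (a * b * q) (q * q) k) γ ⟩
        ratioDen q a b c d k * (δ₁ * δ₂ * γ) ∎

      ratioNum-suc : ratioNum q a b c (sucℕ k) ≈ ratioNum q a b c k * φ
      ratioNum-suc = begin
        poch a q k * (1# - a * x) * (poch b q k * (1# - b * x)) * (poch c (q * q) k * (1# - c * pow (q * q) k))
          ≈⟨ *-congˡ (*-congˡ (1-z·q²ᵏ≈1-z·x² c)) ⟩
        poch a q k * (1# - a * x) * (poch b q k * (1# - b * x)) * (poch c (q * q) k * (1# - c * (x * x)))
          ≈⟨ solve 6 (λ A α B β C γ → A :* α :* (B :* β) :* (C :* γ) := A :* B :* C :* (α :* β :* γ))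
               refl (poch a q k) (1# - a * x) (poch b q k) (1# - b * x) (poch c (q * q) k) (1# - c * (x * x)) ⟩
        ratioNum q a b c k * φ ∎

      summandDen-shift : summandDen q (a * (q * q)) b c d k * β ≈ ratioDen q a b c d k * (δ₁ * δ₂ * γ)
      summandDen-shift = begin
        poch d q k * δ₁ * (poch e q k * δ₂) * G′ * β    ≈⟨ *-assoc _ G′ β ⟩
        poch d q k * δ₁ * (poch e q k * δ₂) * (G′ * β)  ≈⟨ *-congˡ G′β≈G₊ ⟩
        ratioDen q a b c d (sucℕ k)                     ≈⟨ ratioDen-suc ⟩
        ratioDen q a b c d k * (δ₁ * δ₂ * γ)            ∎
        where
        G′ : Carrier
        G′ = poch (a * (q * q) * b * q) (q * q) k
        G′β≈G₊ : G′ * β ≈ poch (a * b * q) (q * q) (sucℕ k)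
        G′β≈G₊ = begin
          G′ * β
            ≈⟨ *-comm G′ β ⟩
          β * G′
            ≈⟨ *-congˡ (poch-congˡ (q * q) k
                 (solve 3 (λ a b q → a :* b :* q :* (q :* q) := a :* (q :* q) :* b :* q) refl a b q)) ⟨
          β * poch (a * b * q * (q * q)) (q * q) k
            ≈⟨ poch-suc-shift (a * b * q) (q * q) k ⟨
          poch (a * b * q) (q * q) (sucℕ k) ∎

      ratioNum-shift : ratioNum q (a * (q * q)) b c k * poch a q 2
                         ≈ ratioNum q a b c k * ((1# - a * x) * (1# - a * (x * q)))
      ratioNum-shift = begin
        poch (a * (q * q)) q k * B * Cq * poch a q 2
          ≈⟨ solve 4 (λ A′ B C P → A′ :* B :* C :* P := A′ :* P :* (B :* C))
               refl (poch (a * (q * q)) q k) B Cq (poch a q 2) ⟩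
        poch (a * (q * q)) q k * poch a q 2 * (B * Cq)
          ≈⟨ *-congʳ (poch-shift₂ a q k) ⟩
        poch a q k * (1# - a * x) * (1# - a * (x * q)) * (B * Cq)
          ≈⟨ solve 5 (λ A α α′ B C → A :* α :* α′ :* (B :* C) := A :* B :* C :* (α :* α′))
               refl (poch a q k) (1# - a * x) (1# - a * (x * q)) B Cq ⟩
        ratioNum q a b c k * ((1# - a * x) * (1# - a * (x * q))) ∎
        where
        B Cq : Carrier
        B  = poch b q k
        Cq = poch c (q * q) k

      ratioDen≉0 : summandDen q a b c d k ≉ 0# → ratioDen q a b c d k ≉ 0#
      ratioDen≉0 = ≉0-factorˡ ∘ ≉0-resp-≈ summandDen≈ratioDen*δ₁δ₂

      δ₁δ₂≉0 : summandDen q a b c d k ≉ 0# → δ₁ * δ₂ ≉ 0#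
      δ₁δ₂≉0 = ≉0-factorʳ ∘ ≉0-resp-≈ summandDen≈ratioDen*δ₁δ₂

      γ≉0 : ratioDen q a b c d (sucℕ k) ≉ 0# → γ ≉ 0#
      γ≉0 = ≉0-factorʳ ∘ ≉0-factorʳ ∘ ≉0-resp-≈ ratioDen-suc

      summand-ratio : summandDen q a b c d k ≉ 0# → summand q a b c d k * (δ₁ * δ₂) ≈ ratio q a b c d k * x
      summand-ratio sd≉0 = /-rescale (ratioDen≉0 sd≉0) sd≉0
        (trans (*-identityʳ _) summandDen≈ratioDen*δ₁δ₂) (trans (*-identityʳ _) (*-comm x _))

      ratio-suc : ratioDen q a b c d (sucℕ k) ≉ 0# → ratioDen q a b c d k ≉ 0# →
        ratio q a b c d (sucℕ k) * (δ₁ * δ₂ * γ) ≈ ratio q a b c d k * φ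
      ratio-suc rd₊≉0 rd≉0 = /-rescale rd≉0 rd₊≉0
        (trans (*-identityʳ _) ratioDen-suc) (trans (*-identityʳ _) ratioNum-suc)

      shifted-summand-ratio : summandDen q (a * (q * q)) b c d k ≉ 0# → ratioDen q a b c d k ≉ 0# →
        summand q (a * (q * q)) b c d k * (δ₁ * δ₂ * γ * poch a q 2) ≈ ratio q a b c d k * (x * ψ)
      shifted-summand-ratio sd′≉0 rd≉0 = /-rescale rd≉0 sd′≉0
        (begin
          summandDen q (a * (q * q)) b c d k * (β * poch a q 2)  ≈⟨ *-assoc _ β (poch a q 2) ⟨
          summandDen q (a * (q * q)) b c d k * β * poch a q 2    ≈⟨ *-congʳ summandDen-shift ⟩
          ratioDen q a b c d k * (δ₁ * δ₂ * γ) * poch a q 2      ≈⟨ *-assoc _ (δ₁ * δ₂ * γ) (poch a q 2) ⟩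
          ratioDen q a b c d k * (δ₁ * δ₂ * γ * poch a q 2)      ∎)
        (begin
          x * N′ * (β * poch a q 2)
            ≈⟨ solve 4 (λ x N′ β P → x :* N′ :* (β :* P) := x :* (N′ :* P) :* β) refl x N′ β (poch a q 2) ⟩
          x * (N′ * poch a q 2) * β
            ≈⟨ *-congʳ (*-congˡ ratioNum-shift) ⟩
          x * (ratioNum q a b c k * ((1# - a * x) * (1# - a * (x * q)))) * β
            ≈⟨ solve 5 (λ x N α α′ β → x :* (N :* (α :* α′)) :* β := N :* (x :* (α :* α′ :* β)))
                 refl x (ratioNum q a b c k) (1# - a * x) (1# - a * (x * q)) β ⟩
          ratioNum q a b c k * (x * ψ) ∎)
        where
        N′ : Carrier
        N′ = ratioNum q (a * (q * q)) b c k

      summand-identity :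
        x * γ * Δ₁ * V ≈ d * (c - a * b * q) * V * (x * ψ) + a * q * (δ₁ * U * γ - φ * (d * q)) * Δ₁
      summand-identity = solve 6 (λ a b c d q x →
          x :* (:1 :- a :* b :* q :* (x :* x))
            :* ((c :- a :* d :* q) :* (d :- a) :* (:1 :- a :* b :* q))
            :* ((c :- a :* d :* q) :* (d :* q :- a :* q))
        := d :* (c :- a :* b :* q) :* ((c :- a :* d :* q) :* (d :* q :- a :* q))
             :* (x :* ((:1 :- a :* x) :* (:1 :- a :* (x :* q)) :* (:1 :- a :* b :* q)))
           :+ a :* q
             :* ((:1 :- d :* x) :* (d :* q :- c :* x) :* (:1 :- a :* b :* q :* (x :* x))
                 :- (:1 :- a :* x) :* (:1 :- b :* x) :* (:1 :- c :* (x :* x)) :* (d :* q))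
             :* ((c :- a :* d :* q) :* (d :- a) :* (:1 :- a :* b :* q)))
        refl a b c d q x

      Δ₂dq≈V : d ≉ 0# → Δ₂ * (d * q) ≈ V
      Δ₂dq≈V d≉0 = begin
        Δ₂ * (d * q)
          ≈⟨ solve 5 (λ c a d q r → (c :- a :* d :* q) :* (:1 :- r) :* (d :* q)
                                    := (c :- a :* d :* q) :* (d :* q :- r :* d :* q)) refl c a d q (a / d) ⟩
        (c - a * d * q) * (d * q - a / d * d * q)
          ≈⟨ *-congˡ (+-congˡ (-‿cong (*-congʳ (x/y*y≈x a d≉0)))) ⟩
        V ∎

      δ₂dq≈U : d * q ≉ 0# → δ₂ * (d * q) ≈ U
      δ₂dq≈U dq≉0 = begin
        (1# - e * x) * (d * q)  ≈⟨ solve 3 (λ e x p → (:1 :- e :* x) :* p := p :- e :* p :* x) refl e x (d * q) ⟩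
        d * q - e * (d * q) * x ≈⟨ +-congˡ (-‿cong (*-congʳ (x/y*y≈x c dq≉0))) ⟩
        U                       ∎

      summand-recurrence : d * q ≉ 0# → d ≉ 0# →
        summandDen q a b c d k ≉ 0# → summandDen q (a * (q * q)) b c d k ≉ 0# →
        Δ₁ ≉ 0# → Δ₂ ≉ 0# → ratioDen q a b c d (sucℕ k) ≉ 0# →
        summand q a b c d k
          ≈ C * summand q (a * (q * q)) b c d k + D * (ratio q a b c d k - ratio q a b c d (sucℕ k))
      summand-recurrence dq≉0 d≉0 sd≉0 sd′≉0 Δ₁≉0 Δ₂≉0 rd₊≉0 = *-cancelʳ-≉0 M≉0 (begin
        T * M                                    ≈⟨ T-term ⟩
        R₀ * (x * γ * Δ₁ * V)                    ≈⟨ *-congˡ summand-identity ⟩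
        R₀ * (P + Q)                             ≈⟨ distribˡ R₀ P Q ⟩
        R₀ * P + R₀ * Q                          ≈⟨ +-cong C-term D-term ⟨
        C * T′ * M + D * (R₀ - R₁) * M           ≈⟨ distribʳ M (C * T′) (D * (R₀ - R₁)) ⟨
        (C * T′ + D * (R₀ - R₁)) * M             ∎)
        where
        T T′ R₀ R₁ M P Q : Carrier
        T  = summand q a b c d k
        T′ = summand q (a * (q * q)) b c d k
        R₀ = ratio q a b c d k
        R₁ = ratio q a b c d (sucℕ k)
        M  = δ₁ * δ₂ * γ * Δ₁ * (Δ₂ * (d * q))
        P  = d * (c - a * b * q) * V * (x * ψ)
        Q  = a * q * (δ₁ * U * γ - φ * (d * q)) * Δ₁

        M≉0 : M ≉ 0#
        M≉0 = *-≉0 (*-≉0 (*-≉0 (δ₁δ₂≉0 sd≉0) (γ≉0 rd₊≉0)) Δ₁≉0) (*-≉0 Δ₂≉0 dq≉0)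

        T-term : T * M ≈ R₀ * (x * γ * Δ₁ * V)
        T-term = begin
          T * M
            ≈⟨ solve 6 (λ T δ₁ δ₂ γ Δ₁ W → T :* (δ₁ :* δ₂ :* γ :* Δ₁ :* W) := T :* (δ₁ :* δ₂) :* (γ :* Δ₁ :* W))
                 refl T δ₁ δ₂ γ Δ₁ (Δ₂ * (d * q)) ⟩
          T * (δ₁ * δ₂) * (γ * Δ₁ * (Δ₂ * (d * q)))
            ≈⟨ *-cong (summand-ratio sd≉0) (*-congˡ (Δ₂dq≈V d≉0)) ⟩
          R₀ * x * (γ * Δ₁ * V)
            ≈⟨ solve 5 (λ R x γ Δ₁ V → R :* x :* (γ :* Δ₁ :* V) := R :* (x :* γ :* Δ₁ :* V)) refl R₀ x γ Δ₁ V ⟩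
          R₀ * (x * γ * Δ₁ * V) ∎

        C-term : C * T′ * M ≈ R₀ * P
        C-term = begin
          C * T′ * M
            ≈⟨ solve 7 (λ C T′ δ₁ δ₂ γ Δ₁ W → C :* T′ :* (δ₁ :* δ₂ :* γ :* Δ₁ :* W)
                                             := C :* Δ₁ :* T′ :* (δ₁ :* δ₂ :* γ) :* W)
                 refl C T′ δ₁ δ₂ γ Δ₁ (Δ₂ * (d * q)) ⟩
          C * Δ₁ * T′ * (δ₁ * δ₂ * γ) * (Δ₂ * (d * q))
            ≈⟨ *-cong (*-congʳ (*-congʳ (x/y*y≈x (d * poch a q 2 * (c - a * b * q)) Δ₁≉0))) (Δ₂dq≈V d≉0) ⟩
          d * poch a q 2 * (c - a * b * q) * T′ * (δ₁ * δ₂ * γ) * V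
            ≈⟨ solve 6 (λ d P c′ T′ ε V → d :* P :* c′ :* T′ :* ε :* V := d :* c′ :* (T′ :* (ε :* P)) :* V)
                 refl d (poch a q 2) (c - a * b * q) T′ (δ₁ * δ₂ * γ) V ⟩
          d * (c - a * b * q) * (T′ * (δ₁ * δ₂ * γ * poch a q 2)) * V
            ≈⟨ *-congʳ (*-congˡ (shifted-summand-ratio sd′≉0 (ratioDen≉0 sd≉0))) ⟩
          d * (c - a * b * q) * (R₀ * (x * ψ)) * V
            ≈⟨ solve 5 (λ d c′ R y V → d :* c′ :* (R :* y) :* V := R :* (d :* c′ :* V :* y))
                 refl d (c - a * b * q) R₀ (x * ψ) V ⟩
          R₀ * P ∎

        D-term : D * (R₀ - R₁) * M ≈ R₀ * Q
        D-term = begin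
          D * (R₀ - R₁) * M
            ≈⟨ solve 9 (λ D R₀ R₁ δ₁ δ₂ γ Δ₁ Δ₂ p →
                   D :* (R₀ :- R₁) :* (δ₁ :* δ₂ :* γ :* Δ₁ :* (Δ₂ :* p))
                := D :* Δ₂ :* (R₀ :* (δ₁ :* (δ₂ :* p) :* γ) :- R₁ :* (δ₁ :* δ₂ :* γ) :* p) :* Δ₁)
                 refl D R₀ R₁ δ₁ δ₂ γ Δ₁ Δ₂ (d * q) ⟩
          D * Δ₂ * (R₀ * (δ₁ * (δ₂ * (d * q)) * γ) - R₁ * (δ₁ * δ₂ * γ) * (d * q)) * Δ₁
            ≈⟨ *-congʳ (*-cong (x/y*y≈x (a * q) Δ₂≉0)
                 (+-cong (*-congˡ (*-congʳ (*-congˡ (δ₂dq≈U dq≉0))))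
                         (-‿cong (*-congʳ (ratio-suc rd₊≉0 (ratioDen≉0 sd≉0)))))) ⟩
          a * q * (R₀ * (δ₁ * U * γ) - R₀ * φ * (d * q)) * Δ₁
            ≈⟨ solve 9 (λ a q R δ₁ U γ φ p Δ₁ → a :* q :* (R :* (δ₁ :* U :* γ) :- R :* φ :* p) :* Δ₁
                                            := R :* (a :* q :* (δ₁ :* U :* γ :- φ :* p) :* Δ₁))
                 refl a q R₀ δ₁ U γ φ (d * q) Δ₁ ⟩
          R₀ * Q ∎

  ratioDen≉0-upto : ∀ {q a b c d n} →
    (∀ k → k < n → summandDen q a b c d k ≉ 0#) → ratioDen q a b c d n ≉ 0# →
    ∀ {k} → k ≤ n → ratioDen q a b c d k ≉ 0#
  ratioDen≉0-upto {q} {a} {b} {c} {d} sd≉0 rdₙ≉0 {k} k≤n with ℕ.m≤n⇒m<n∨m≡n k≤n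
  ... | inj₁ k<n    = Contiguity.ratioDen≉0 q a b c d k (sd≉0 k k<n)
  ... | inj₂ ≡.refl = rdₙ≉0

theorem3p6 : ∀ {ℓc ℓ} (F : Field ℓc ℓ) → let open Field F in
  (q a b c d : Carrier) (n : ℕ) →
  -- no denominator vanishes
  d * q ≉ 0# →
  d ≉ 0# →
  (∀ k → k < n →
    poch d q (sucℕ k) * poch (c / (d * q)) q (sucℕ k) * poch (a * b * q) (q * q) k ≉ 0#) →
  (∀ k → k < n →
    poch d q (sucℕ k) * poch (c / (d * q)) q (sucℕ k)
      * poch ((a * (q * q)) * b * q) (q * q) k ≉ 0#) →
  (c - a * d * q) * (d - a) * (1# - a * b * q) ≉ 0# →
  (c - a * d * q) * (1# - a / d) ≉ 0# →
  poch d q n * poch (c / (d * q)) q n * poch (a * b * q) (q * q) n ≉ 0# →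
  Xi q a b c d n ≈
    (d * poch a q 2 * (c - a * b * q))
      / ((c - a * d * q) * (d - a) * (1# - a * b * q))
      * Xi q (a * (q * q)) b c d n
    + (a * q) / ((c - a * d * q) * (1# - a / d))
      * (1# - (poch a q n * poch b q n * poch c (q * q) n)
              / (poch d q n * poch (c / (d * q)) q n * poch (a * b * q) (q * q) n))
theorem3p6 F q a b c d n dq≉0 d≉0 sd≉0 sd′≉0 Δ₁≉0 Δ₂≉0 rdₙ≉0 = begin
  Xi q a b c d n
    ≈⟨ sumTo-telescope n (λ k k<n →
         summand-recurrence k dq≉0 d≉0 (sd≉0 k k<n) (sd′≉0 k k<n) Δ₁≉0 Δ₂≉0
           (ratioDen≉0-upto sd≉0 rdₙ≉0 k<n)) ⟩
  C * Xi q (a * (q * q)) b c d n + D * (ratio q a b c d 0 - ratio q a b c d n)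
    ≈⟨ +-congˡ (*-congˡ (+-congʳ (ratio-zero q a b c d))) ⟩
  C * Xi q (a * (q * q)) b c d n + D * (1# - ratio q a b c d n) ∎
  where
  open Field F
  open Recurrence F
  open Contiguity q a b c d
  open import Relation.Binary.Reasoning.Setoid setoid
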